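{- Let $a,b$ be coprime positive integers and $d$ an integer with $1\le d<b-1$ and $d\mid(b-1)$. Suppose $(P,Q)\in NC_d(a,b)$ and $P$ contains a central block containing $1$. Then $Q$ contains no wrapping blocks.
   Context: An $a,b$-Dyck path is a lattice path from $(0,0)$ to $(b,a)$ with unit north steps $N$ and east steps $E$ staying above the line $y=\frac{a}{b}x$; write it as $D=N^{v_0}EN^{v_1}E\cdots N^{v_{b-1}}E$, $v_i\ge 0$. A vertical run of length $v$ is a $P$-rise if $v>a/b$ and a $Q$-rise if $v<a/b$. For $1\le i\le b-1$ the label $i$ is the point $(i,v_0+\dots+v_{i-1})$. If $v_i>0$, the laser $\ell(i)$ is the segment of slope $a/b$ from label $i$ going northeast until it next meets $D$ (in the interior of an east step). $\ell(D)$ is the set of pairs $(i,j)$ with $\ell(i)$ ending on the east step whose west endpoint has $x$-coordinate $j$. The labeled pair $\pi(D)=(P,Q)$ of set partitions of $[b-1]$: $i,j$ in the same block of $P$ iff labels $i,j$ are not separated by any laser (label $k$ lies strictly below $\ell(k)$), and a block $B\in P$ gets rank $v_{\min(B)-1}$; $Q$ is the equivalence relation generated by $i\sim j$ whenever $\ell(i),\ell(j)$ end on the same east step immediately following a $Q$-rise, or $(i,j)\in\ell(D)$, or $(j,i)\in\ell(D)$, and a block $B\in Q$ gets rank $v_{\max(B)}$. $NC(a,b)=\{\pi(D)\}$ over all $a,b$-Dyck paths; $P,Q$ are noncrossing. $\mathrm{rot}$ acts by $i\mapsto i+1$ ($b-1\mapsto1$) on all blocks, ranks kept. $NC_d(a,b)$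 is the set of $(P,Q)\in NC(a,b)$ with $\mathrm{rot}^d(P,Q)=(P,Q)$. For a $\mathrm{rot}^d$-invariant noncrossing partition, a block $B$ is central if $\mathrm{rot}^d(B)=B$, and wrapping if it is not central and every block of its $\langle\mathrm{rot}^d\rangle$-orbit is contained in the interval $[\min B,\max B]$. -}

module Defs where

open import Data.Nat using (ℕ; zero; suc; _+_; _*_; _∸_; _≤_; _<_; _<ᵇ_)
open import Data.Bool using (if_then_else_)
open import Data.List using (List; []; _∷_; length; take)
open import Data.Nat.ListAction using (sum)
open import Data.Product using (Σ; ∃; ∃-syntax; _×_; _,_)
open import Data.Sum using (_⊎_)
open import Function using (_⇔_)
open import Relation.Nullary using (¬_)
open import Relation.Binary.PropositionalEquality using (_≡_)
open import Relation.Binary.Construct.Closure.Equivalence using (EqClosure)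

-- a,b-Dyck paths  D = N^{v_0} E N^{v_1} E ... N^{v_{b-1}} E,
-- stored as the list of run lengths [v_0, ..., v_{b-1}].

vAt : List ℕ → ℕ → ℕ
vAt []       _       = 0
vAt (x ∷ xs) zero    = x
vAt (x ∷ xs) (suc i) = vAt xs i

-- h_i = v_0 + ... + v_{i-1}  (height of the path at the start of column i)
ht : List ℕ → ℕ → ℕ
ht vs i = sum (take i vs)

record Dyck (a b : ℕ) : Set where
  field
    runs  : List ℕ
    len   : length runs ≡ b
    total : sum runs ≡ a
    -- the lattice points (i , h_i) stay (weakly) above y = (a/b) x
    above : ∀ i → i ≤ b → a * i ≤ b * ht runs i

open Dyck public

Label : ℕ → ℕ → Set
Label n x = 1 ≤ x × x ≤ n

module _ {a b : ℕ} (D : Dyck a b) where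

  v : ℕ → ℕ
  v = vAt (runs D)

  h : ℕ → ℕ
  h = ht (runs D)

  -- LaserEnds k j : v_k > 0 and the laser ℓ(k) from label k = (k , h_k),
  -- of slope a/b, i.e. the line y = h_k + (a/b)(x - k), first leaves the
  -- region under D through the interior of the east step
  -- [(j , h_{j+1}) , (j+1 , h_{j+1})] : it is at or below the path at the
  -- right ends x = j'+1 of all earlier columns, and strictly above the
  -- east step at x = j+1.  Equivalently (k , j) ∈ ℓ(D).
  LaserEnds : ℕ → ℕ → Set
  LaserEnds k j =
    Label (b ∸ 1) k × 0 < v k × k ≤ j × j < b
    × (b * h (suc j) < b * h k + a * (suc j ∸ k))
    × (∀ j' → k ≤ j' → j' < j → b * h k + a * (suc j' ∸ k) ≤ b * h (suc j'))

  -- label m lies strictly above the laser ℓ(k) (inside the horizontal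
  -- extent of ℓ(k)); label k itself counts as lying below ℓ(k).
  AboveLaser : ℕ → ℕ → Set
  AboveLaser k m = ∃[ j ] (LaserEnds k j × k < m × m ≤ j
                           × b * h k + a * (m ∸ k) < b * h m)

  -- P : labels x, y are not separated by any laser
  SameP : ℕ → ℕ → Set
  SameP x y = ∀ k → Label (b ∸ 1) k → (AboveLaser k x ⇔ AboveLaser k y)

  QGen : ℕ → ℕ → Set
  QGen x y = Label (b ∸ 1) x × Label (b ∸ 1) y ×
    ( (∃[ e ] (LaserEnds x e × LaserEnds y e × b * v e < a))  -- same east step after a Q-rise
    ⊎ LaserEnds x y
    ⊎ LaserEnds y x )

  SameQ : ℕ → ℕ → Set
  SameQ = EqClosure QGen

IsMin : ℕ → (ℕ → ℕ → Set) → ℕ → ℕ → Set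
IsMin n R x m = Label n m × R x m × (∀ k → Label n k → R x k → m ≤ k)

IsMax : ℕ → (ℕ → ℕ → Set) → ℕ → ℕ → Set
IsMax n R x m = Label n m × R x m × (∀ k → Label n k → R x k → k ≤ m)

module _ {a b : ℕ} (D : Dyck a b) where
  RankP : ℕ → ℕ → Set
  RankP x r = ∃[ m ] (IsMin (b ∸ 1) (SameP D) x m × r ≡ v D (m ∸ 1))

  RankQ : ℕ → ℕ → Set
  RankQ x r = ∃[ m ] (IsMax (b ∸ 1) (SameQ D) x m × r ≡ v D m)

rot : ℕ → ℕ → ℕ
rot n x = if x <ᵇ n then suc x else 1

rotIter : ℕ → ℕ → ℕ → ℕ
rotIter n zero    x = x
rotIter n (suc k) x = rot n (rotIter n k x)

InRotImage : ℕ → ℕ → (ℕ → Set) → ℕ → Set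
InRotImage n m B y = ∃[ z ] (Label n z × B z × rotIter n m z ≡ y)

-- rot^d (R , rank) = (R , rank) for a labeled partition of [n]
-- (blocks of rot^d R are the images rot^d(B), with rank of B)
RotInvariant : ℕ → ℕ → (ℕ → ℕ → Set) → (ℕ → ℕ → Set) → Set
RotInvariant n d R rank =
  (∀ x y → Label n x → Label n y →
     (R x y ⇔ (∃[ x' ] ∃[ y' ] (Label n x' × Label n y' ×
                rotIter n d x' ≡ x × rotIter n d y' ≡ y × R x' y'))))
  × (∀ x r r' → Label n x → rank x r → rank (rotIter n d x) r' → r ≡ r')

InNCd : ∀ {a b} → ℕ → Dyck a b → Set
InNCd {a} {b} d D =
  RotInvariant (b ∸ 1) d (SameP D) (RankP D)
  × RotInvariant (b ∸ 1) d (SameQ D) (RankQ D)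

Central : ℕ → ℕ → (ℕ → ℕ → Set) → ℕ → Set
Central n d R x = ∀ y → Label n y → (R x y ⇔ InRotImage n d (R x) y)

Wrapping : ℕ → ℕ → (ℕ → ℕ → Set) → ℕ → Set
Wrapping n d R x =
  ¬ Central n d R x
  × ∃[ mn ] ∃[ mx ] (IsMin n R x mn × IsMax n R x mx
      × (∀ k y → Label n y → InRotImage n (k * d) (R x) y → mn ≤ y × y ≤ mx))

-- The central P-block of 1 contains the whole progression 1, 1 + d, …, p = n + 1 − d
-- (n = b − 1).  Label 1 lies above no laser, so neither does any label in its P-block;
-- in particular p lies above no laser.  Since a and b are coprime, a laser never passes
-- through a label, so a laser starting left of p and ending at or beyond p would have p
-- strictly above it.  Hence every generator of Q, and so every Q-block, stays on one side
-- of p.  A wrapping Q-block B has rot^d(B) inside [min B, max B]; rotating max B must wrap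
-- around, forcing max B ≥ p, while rotating min B must not, forcing min B < p.
module Submission where

open import Defs
open import Data.Nat using (ℕ; _≤_; _<_; _∸_)
open import Data.Nat.Divisibility using (_∣_)
open import Data.Nat.Coprimality using (Coprime)
open import Relation.Nullary using (¬_)

open import Data.Nat using (zero; suc; _+_; _*_; _<ᵇ_; s≤s; s≤s⁻¹)
open import Data.Nat.Properties
open import Data.Nat.Base using (>-nonZero)
open import Data.Nat.Divisibility using (divides; ∣⇒≤; ∣m+n∣m⇒∣n; m∣m*n)
import Data.Nat.Coprimality as Coprime
open import Data.Bool using (true; false; T)
open import Data.Unit using (tt)
open import Data.Empty using (⊥-elim)
open import Data.Product using (_×_; _,_; proj₁; proj₂; ∃-syntax)
open import Data.Sum using (inj₁; inj₂)
open import Function using (_⇔_; _∘_; mk⇔; Equivalence)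
open import Function.Properties.Equivalence using (⇔-isEquivalence)
open import Relation.Nullary using (yes; no; contradiction)
open import Relation.Binary.Structures using (IsEquivalence)
open import Relation.Binary.PropositionalEquality
open import Relation.Binary.Construct.Closure.ReflexiveTransitive using (_◅◅_)
import Relation.Binary.Construct.Closure.Equivalence as EqClosure

rot-< : ∀ {n x} → x < n → rot n x ≡ suc x
rot-< {n} {x} x<n with x <ᵇ n | <⇒<ᵇ x<n
... | true | _ = refl

rot-n : ∀ n → rot n n ≡ 1
rot-n n with n <ᵇ n in eq
... | false = refl
... | true  = contradiction (<ᵇ⇒< n n (subst T (sym eq) tt)) (n≮n n)

rotIter-+ : ∀ {n} z d → z + d ≤ n → rotIter n d z ≡ z + d
rotIter-+ z zero    _ = sym (+-identityʳ z)
rotIter-+ {n} z (suc d) z+1+d≤n rewrite +-suc z d =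
  trans (cong (rot n) (rotIter-+ z d (<⇒≤ z+1+d≤n))) (rot-< z+1+d≤n)

rotIter-wrap : ∀ {n d z} → z ≤ n → d < n → n < z + d → rotIter n d z ≡ z + d ∸ n
rotIter-wrap {n} {zero} {z} z≤n′ _ n<z+0 =
  contradiction (subst (n <_) (+-identityʳ z) n<z+0) (≤⇒≯ z≤n′)
rotIter-wrap {n} {suc d} {z} z≤n′ 1+d<n n<z+1+d with n <? z + d
... | yes n<z+d = begin
  rot n (rotIter n d z)   ≡⟨ cong (rot n) (rotIter-wrap z≤n′ d<n n<z+d) ⟩
  rot n (z + d ∸ n)       ≡⟨ rot-< z+d∸n<n ⟩
  1 + (z + d ∸ n)         ≡⟨ +-∸-assoc 1 (<⇒≤ n<z+d) ⟨
  1 + (z + d) ∸ n         ≡⟨ cong (_∸ n) (+-suc z d) ⟨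
  z + suc d ∸ n           ∎
  where
  open ≡-Reasoning
  d<n = <-trans (n<1+n d) 1+d<n
  z+d∸n<n : z + d ∸ n < n
  z+d∸n<n = subst (z + d ∸ n <_) (m+n∸n≡m n n)
              (∸-monoˡ-< (+-mono-≤-< z≤n′ d<n) (<⇒≤ n<z+d))
... | no n≮z+d = begin
  rot n (rotIter n d z)   ≡⟨ cong (rot n) (rotIter-+ z d (≮⇒≥ n≮z+d)) ⟩
  rot n (z + d)           ≡⟨ cong (rot n) z+d≡n ⟩
  rot n n                 ≡⟨ rot-n n ⟩
  1                       ≡⟨ m+n∸n≡m 1 n ⟨
  suc n ∸ n               ≡⟨ cong (λ m → suc m ∸ n) z+d≡n ⟨
  suc (z + d) ∸ n         ≡⟨ cong (_∸ n) (+-suc z d) ⟨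
  z + suc d ∸ n           ∎
  where
  open ≡-Reasoning
  z+d≡n : z + d ≡ n
  z+d≡n = ≤-antisym (≮⇒≥ n≮z+d) (s≤s⁻¹ (subst (n <_) (+-suc z d) n<z+1+d))

module _ {n d : ℕ} {B : ℕ → Set} where

  orbit-max-wraps : ∀ {mx} → 1 ≤ d → Label n mx → B mx →
                    (∀ y → Label n y → InRotImage n d B y → y ≤ mx) →
                    n < mx + d
  orbit-max-wraps {mx} 1≤d lmx@(1≤mx , _) Bmx bounded with n <? mx + d
  ... | yes n<mx+d = n<mx+d
  ... | no  n≮mx+d = contradiction
          (bounded (mx + d) (≤-trans 1≤mx (m≤m+n mx d) , ≮⇒≥ n≮mx+d)
                   (mx , lmx , Bmx , rotIter-+ mx d (≮⇒≥ n≮mx+d)))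
          (<⇒≱ (m<m+n mx 1≤d))

  orbit-min-stays : ∀ {mn} → d < n → Label n mn → B mn →
                    (∀ y → Label n y → InRotImage n d B y → mn ≤ y) →
                    mn + d ≤ n
  orbit-min-stays {mn} d<n lmn@(_ , mn≤n) Bmn bounded with n <? mn + d
  ... | no  n≮mn+d = ≮⇒≥ n≮mn+d
  ... | yes n<mn+d = contradiction (m≤o∸n⇒m+n≤o mn (<⇒≤ n<mn+d) mn≤t) (<⇒≱ (+-monoʳ-< mn d<n))
    where
    t = mn + d ∸ n
    lt : Label n t
    lt = m<n⇒0<n∸m n<mn+d , m≤n+o⇒m∸n≤o (mn + d) n (+-mono-≤ mn≤n (<⇒≤ d<n))
    mn≤t : mn ≤ t
    mn≤t = bounded t lt (mn , lmn , Bmn , rotIter-wrap mn≤n d<n n<mn+d)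

module _ {n d : ℕ} {R : ℕ → ℕ → Set} {x : ℕ} (central : Central n d R x) where

  central-∋-+ : ∀ {y} → Label n y → R x y → y + d ≤ n → R x (y + d)
  central-∋-+ {y} ly@(1≤y , _) Rxy y+d≤n =
    Equivalence.from (central (y + d) (≤-trans 1≤y (m≤m+n y d) , y+d≤n))
      (y , ly , Rxy , rotIter-+ y d y+d≤n)

  central-∋-progression : R x x → 1 ≤ x → ∀ j → x + j * d ≤ n → R x (x + j * d)
  central-∋-progression Rxx _   zero    _  = subst (R x) (sym (+-identityʳ x)) Rxx
  central-∋-progression Rxx 1≤x (suc j) le =
    subst (R x) y+d≡x+[1+j]*d
      (central-∋-+ (≤-trans 1≤x (m≤m+n x (j * d)) , y≤n)
                   (central-∋-progression Rxx 1≤x j y≤n) y+d≤n)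
    where
    y+d≡x+[1+j]*d : x + j * d + d ≡ x + suc j * d
    y+d≡x+[1+j]*d = trans (+-assoc x (j * d) d) (cong (x +_) (+-comm (j * d) d))
    y+d≤n : x + j * d + d ≤ n
    y+d≤n = subst (_≤ n) (sym y+d≡x+[1+j]*d) le
    y≤n : x + j * d ≤ n
    y≤n = ≤-trans (m≤m+n (x + j * d) d) y+d≤n

b*u+a*c≢b*w : ∀ {a b c} u w → Coprime a b → 0 < c → c < b → b * u + a * c ≢ b * w
b*u+a*c≢b*w {b = b} {c} u w coprime 0<c c<b b*u+a*c≡b*w =
  <⇒≱ c<b (∣⇒≤ {{>-nonZero 0<c}} b∣c)
  where
  b∣c : b ∣ c
  b∣c = Coprime.coprime-divisor (Coprime.sym coprime)
          (∣m+n∣m⇒∣n (subst (b ∣_) (sym b*u+a*c≡b*w) (m∣m*n w)) (m∣m*n u))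

module _ {a b : ℕ} (D : Dyck a b) where

  NoLaserBelow : ℕ → Set
  NoLaserBelow p = ∀ k → Label (b ∸ 1) k → ¬ AboveLaser D k p

  sameP-1⇒noLaserBelow : ∀ {p} → SameP D 1 p → NoLaserBelow p
  sameP-1⇒noLaserBelow 1~p k lk p-above-ℓk with Equivalence.from (1~p k lk) p-above-ℓk
  ... | _ , _ , k<1 , _ = <⇒≱ k<1 (proj₁ lk)

  qGen-sym : ∀ {x y} → QGen D x y → QGen D y x
  qGen-sym (lx , ly , inj₁ (e , ℓx , ℓy , qRise)) = ly , lx , inj₁ (e , ℓy , ℓx , qRise)
  qGen-sym (lx , ly , inj₂ (inj₁ ℓxy))            = ly , lx , inj₂ (inj₂ ℓxy)
  qGen-sym (lx , ly , inj₂ (inj₂ ℓyx))            = ly , lx , inj₂ (inj₁ ℓyx)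

  module _ (coprime : Coprime a b) where

    laserEnds⇒aboveLaser : ∀ {k j p} → LaserEnds D k j → k < p → p ≤ j → AboveLaser D k p
    laserEnds⇒aboveLaser {k} {j} {suc p} ℓ@(_ , _ , _ , j<b , _ , underPath) k<p p≤j =
      j , ℓ , k<p , p≤j ,
      ≤∧≢⇒< (underPath p (s≤s⁻¹ k<p) p≤j)
            (b*u+a*c≢b*w (h D k) (h D (suc p)) coprime (m<n⇒0<n∸m k<p) c<b)
      where
      c<b : suc p ∸ k < b
      c<b = ≤-<-trans (m∸n≤m (suc p) k) (<-≤-trans (s≤s p≤j) j<b)

    noLaserBelow⇒laserEnds-< : ∀ {p k j} → NoLaserBelow p → LaserEnds D k j → k < p → j < p
    noLaserBelow⇒laserEnds-< {p} {k} {j} free ℓ k<p with j <? p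
    ... | yes j<p = j<p
    ... | no  j≮p = ⊥-elim (free k (proj₁ ℓ) (laserEnds⇒aboveLaser ℓ k<p (≮⇒≥ j≮p)))

    noLaserBelow⇒qGen-< : ∀ {p x y} → NoLaserBelow p → QGen D x y → x < p → y < p
    noLaserBelow⇒qGen-< free (_ , _ , inj₁ (_ , ℓx , ℓy , _)) x<p =
      ≤-<-trans (proj₁ (proj₂ (proj₂ ℓy))) (noLaserBelow⇒laserEnds-< free ℓx x<p)
    noLaserBelow⇒qGen-< free (_ , _ , inj₂ (inj₁ ℓxy)) x<p = noLaserBelow⇒laserEnds-< free ℓxy x<p
    noLaserBelow⇒qGen-< free (_ , _ , inj₂ (inj₂ ℓyx)) x<p = ≤-<-trans (proj₁ (proj₂ (proj₂ ℓyx))) x<p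

    noLaserBelow⇒sameQ-<-⇔ : ∀ {p x y} → NoLaserBelow p → SameQ D x y → (x < p ⇔ y < p)
    noLaserBelow⇒sameQ-<-⇔ {p} free =
      EqClosure.gfold ⇔-isEquivalence (_< p)
        (λ q → mk⇔ (noLaserBelow⇒qGen-< free q) (noLaserBelow⇒qGen-< free (qGen-sym q)))

lastTerm-progression : ∀ {n d} → d < n → d ∣ n → ∃[ j ] 1 + j * d + d ≡ suc n
lastTerm-progression d<n (divides zero n≡0) = contradiction (subst (_ <_) n≡0 d<n) λ ()
lastTerm-progression {d = d} _ (divides (suc j) n≡[1+j]*d) =
  j , cong suc (trans (+-comm (j * d) d) (sym n≡[1+j]*d))

lemma5p3 : (a b d : ℕ) → 1 ≤ a → 1 ≤ b → Coprime a b →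
           1 ≤ d → d < b ∸ 1 → d ∣ b ∸ 1 →
           (D : Dyck a b) → InNCd d D →
           Central (b ∸ 1) d (SameP D) 1 →
           ∀ x → Label (b ∸ 1) x → ¬ Wrapping (b ∸ 1) d (SameQ D) x
lemma5p3 a b d _ _ coprime 1≤d d<n d∣n D _ central x _
  (_ , mn , mx , (lmn , x~mn , _) , (lmx , x~mx , _) , orbit)
  with lastTerm-progression d<n d∣n
... | j , p+d≡1+n = <⇒≱ mx<p p≤mx
  where
  n = b ∸ 1
  p = 1 + j * d
  orbit₁ : ∀ y → Label n y → InRotImage n d (SameQ D x) y → mn ≤ y × y ≤ mx
  orbit₁ y ly = orbit 1 y ly ∘ subst (λ e → InRotImage n e (SameQ D x) y) (sym (*-identityˡ d))
  mn<p : mn < p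
  mn<p = +-cancelʳ-< d mn p (subst (mn + d <_) (sym p+d≡1+n)
           (s≤s (orbit-min-stays d<n lmn x~mn (λ y ly → proj₁ ∘ orbit₁ y ly))))
  p≤mx : p ≤ mx
  p≤mx = +-cancelʳ-≤ d p mx (subst (_≤ mx + d) (sym p+d≡1+n)
           (orbit-max-wraps 1≤d lmx x~mx (λ y ly → proj₂ ∘ orbit₁ y ly)))
  1~1 : SameP D 1 1
  1~1 _ _ = IsEquivalence.refl ⇔-isEquivalence
  1~p : SameP D 1 p
  1~p = central-∋-progression {R = SameP D} central 1~1 ≤-refl j
          (s≤s⁻¹ (subst (p <_) p+d≡1+n (m<m+n p 1≤d)))
  mx<p : mx < p
  mx<p = Equivalence.to (noLaserBelow⇒sameQ-<-⇔ D coprime (sameP-1⇒noLaserBelow D 1~p)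
                           (EqClosure.symmetric (QGen D) x~mn ◅◅ x~mx)) mn<p
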